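{- (i) For every $n\geq 1$, $s(n)$ divides $s(n-1)+s(n+1)$; more precisely $$\frac{s(n-1)+s(n+1)}{s(n)}=1+2v_2(n).$$ The power series $C(z)=\sum_{n=1}^\infty \frac{s(n-1)+s(n+1)}{s(n)}z^n$ satisfies $C(0)=0$ and $C(z)=z\frac{1+2z}{1-z^2}+C(z^2)$, and is $2$-regular. (ii) For $n\geq 1$: if $n=3\cdot 2^k$ for some $k\geq 0$, then $t(n)=0$ and $t(n-1)+t(n+1)=0$. Otherwise both $t(n)$ and $t(n-1)+t(n+1)$ are non-zero and $t(n)$ divides $t(n-1)+t(n+1)$; more precisely $$\frac{t(n-1)+t(n+1)}{t(n)}=1+2v_2(n)\quad\text{if } n\notin\{2^j: j\geq0\}\cup\{3\cdot 2^j: j\geq 0\},$$ $(t(0)+t(2))/t(1)=-1$, and $$\frac{t(2^e-1)+t(2^e+1)}{t(2^e)}=1+2(e-2)\quad\text{for all } e\geq 1.$$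
   Context: The Stern sequence $s$ is defined by $s(0)=0$, $s(1)=1$, $s(2n)=s(n)$, $s(2n+1)=s(n)+s(n+1)$ for $n\geq1$. The twisted Stern sequence $t$ is defined by $t(0)=0$, $t(1)=1$, $t(2n)=-t(n)$, $t(2n+1)=-t(n)-t(n+1)$ for $n\geq 1$. $v_2(n)$ is the exponent of the highest power of $2$ dividing $n$. A power series $A\in\mathbb Q[[z]]$ is $2$-regular if the smallest vector space containing $A$ and stable under the maps $\rho(i)\left(\sum_n a(n)z^n\right)=\sum_n a(i+2n)z^n$, $i=0,1$, is finite-dimensional. -}

module Defs where

open import Data.Nat as ℕ using (ℕ; zero; suc; _∸_)
open import Data.Nat.DivMod using (_/_; _%_)
open import Data.Bool using (Bool; true; false; if_then_else_)
open import Data.Integer as ℤ using (ℤ; +_; -[1+_])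
open import Data.Rational as ℚ using (ℚ)
open import Data.Fin using (Fin)
open import Data.List using (List; map; upTo; foldr; _∷_; [])
open import Data.Product using (Σ; _×_)
open import Relation.Binary.PropositionalEquality using (_≡_)
import Data.Fin as Fin

isEven : ℕ → Bool
isEven n with n % 2
... | zero = true
... | suc _ = false

-- 2-adic valuation v₂(n): exponent of the highest power of 2 dividing n
-- (for n ≥ 1; convention v₂(0) = 0).  Recursion with fuel; fuel n suffices.

v2-go : ℕ → ℕ → ℕ
v2-go zero    n = 0
v2-go (suc f) zero = 0
v2-go (suc f) (suc m) = if isEven (suc m) then suc (v2-go f (suc m / 2)) else 0

v2 : ℕ → ℕ
v2 n = v2-go n n

-- Stern sequence: s(0)=0, s(1)=1, s(2n)=s(n), s(2n+1)=s(n)+s(n+1).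
-- Defined by recursion with fuel (fuel n suffices since the argument
-- roughly halves at every step).

s-go : ℕ → ℕ → ℕ
s-go zero    _ = 0
s-go (suc f) zero = 0
s-go (suc f) (suc zero) = 1
s-go (suc f) (suc (suc m)) =
  if isEven (suc (suc m))
  then s-go f (suc (suc m) / 2)
  else s-go f (suc (suc m) / 2) ℕ.+ s-go f (suc (suc m / 2))

s : ℕ → ℕ
s n = s-go n n

-- Twisted Stern sequence: t(0)=0, t(1)=1, t(2n)=-t(n), t(2n+1)=-t(n)-t(n+1).

t-go : ℕ → ℕ → ℤ
t-go zero    _ = + 0
t-go (suc f) zero = + 0
t-go (suc f) (suc zero) = + 1
t-go (suc f) (suc (suc m)) =
  if isEven (suc (suc m))
  then ℤ.- t-go f (suc (suc m) / 2)
  else ℤ.- t-go f (suc (suc m) / 2) ℤ.- t-go f (suc (suc m / 2))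

t : ℕ → ℤ
t n = t-go n n

-- Division into ℚ (total; convention x/0 = 0, only used where the
-- denominator is non-zero in the theorem).

divℤ : ℤ → ℤ → ℚ
divℤ p (+ zero)    = ℚ.0ℚ
divℤ p (+ suc d)   = p ℚ./ suc d
divℤ p (-[1+ d ])  = (ℤ.- p) ℚ./ suc d

divℕ : ℕ → ℕ → ℚ
divℕ a b = divℤ (+ a) (+ b)

ℕtoℚ : ℕ → ℚ
ℕtoℚ n = (+ n) ℚ./ 1

ℤtoℚ : ℤ → ℚ
ℤtoℚ z = z ℚ./ 1

PS : Set
PS = ℕ → ℚ

_≈PS_ : PS → PS → Set
A ≈PS B = ∀ n → A n ≡ B n

_+PS_ : PS → PS → PS
(A +PS B) n = A n ℚ.+ B n

_-PS_ : PS → PS → PS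
(A -PS B) n = A n ℚ.- B n

sumℚ : List ℚ → ℚ
sumℚ = foldr ℚ._+_ ℚ.0ℚ

_*PS_ : PS → PS → PS
(A *PS B) n = sumℚ (map (λ i → A i ℚ.* B (n ∸ i)) (upTo (suc n)))

poly : List ℚ → PS
poly []       n       = ℚ.0ℚ
poly (c ∷ cs) zero    = c
poly (c ∷ cs) (suc n) = poly cs n

atZ² : PS → PS
atZ² A n = if isEven n then A (n / 2) else ℚ.0ℚ

constCoeff : PS → ℚ
constCoeff A = A 0

ρ : Fin 2 → PS → PS
ρ i A n = A (Fin.toℕ i ℕ.+ 2 ℕ.* n)

sumFin : (d : ℕ) → (Fin d → ℚ) → ℚ
sumFin zero    f = ℚ.0ℚ
sumFin (suc d) f = f Fin.zero ℚ.+ sumFin d (λ j → f (Fin.suc j))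

InSpan : PS → (d : ℕ) → (Fin d → PS) → Set
InSpan A d B = Σ (Fin d → ℚ) λ c → ∀ n → A n ≡ sumFin d (λ j → c j ℚ.* B j n)

-- A is 2-regular iff the smallest ρ-stable subspace containing A is
-- finite-dimensional, i.e. iff A lies in some finite-dimensional subspace
-- (spanned by B₀,…,B_{d-1}) that is stable under ρ(0), ρ(1).
TwoRegular : PS → Set
TwoRegular A =
  Σ ℕ λ d → Σ (Fin d → PS) λ B →
    InSpan A d B × (∀ (i : Fin 2) (j : Fin d) → InSpan (ρ i (B j)) d B)

Cser : PS
Cser zero    = ℚ.0ℚ
Cser (suc m) = divℕ (s m ℕ.+ s (suc (suc m))) (s (suc m))

tRatio : ℕ → ℚ
tRatio n = divℤ (t (n ∸ 1) ℤ.+ t (suc n)) (t n)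

sRatio : ℕ → ℚ
sRatio n = divℕ (s (n ∸ 1) ℕ.+ s (suc n)) (s n)

module Submission where

-- (i) By the recurrences, s(2m) + s(2m+2) = s(2m+1) and
-- s(2m+1) + s(2m+3) = (s(m) + s(m+2)) + 2 s(m+1), so by induction the neighbour
-- sum of n is (1 + 2 v₂(n)) s(n), and s(n) > 0 for n ≥ 1.  The coefficients of
-- C(z) - C(z²) are therefore 1 at odd and 2 at even positive indices, which is the
-- functional equation, and C, 1/(1 - z) and 1 span a ρ-stable space because
-- C(2n+1) = 1 and C(2n) = C(n) + 2 for n ≥ 1.
--
-- (ii) Write u(n) = t(n-1) + t(n+1).  Then u(2m+1) = t(2m+1) for m ≥ 1 and
-- u(2m) = -u(m) - 2 t(m) for m ≥ 2, so u(a) = R t(a) implies u(2a) = (R + 2) t(2a); this gives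
-- u = (1 + 2k) t at a·2ᵏ for odd a ≥ 3, u = (2e - 3) t at 2ᵉ, and u = t = 0 at 3·2ᵏ.
-- For the zeros: for m ≥ 2 the integers t(m), t(m+1) have the same weak sign and are
-- not both zero, because the recurrence sends the pair (a, b) at m to (-a, -a-b) at
-- 2m and to (-a-b, -b) at 2m+1.  Hence t(2m+1) = -(t(m) + t(m+1)) ≠ 0 for m ≥ 2,
-- and t(n) = 0 only for n = 3·2ᵏ.  Since u = R t with R odd, the remaining claims follow.

open import Defs
open import Data.Nat as ℕ using (ℕ; suc; _∸_; _^_; _≤_)
open import Data.Nat.Divisibility as ℕD using ()
open import Data.Integer as ℤ using (ℤ; +_)
open import Data.Integer.Divisibility as ℤD using ()
open import Data.Rational as ℚ using (ℚ)
open import Data.List using (_∷_; [])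
open import Data.Product using (Σ; _×_)
open import Relation.Binary.PropositionalEquality using (_≡_; _≢_)
open import Relation.Nullary using (¬_)

open import Data.Nat using (zero; _+_; _*_; _<_; z≤n; s≤s)
import Data.Nat.Properties as ℕP
open ℕP using (≤-refl; ≤-trans; <⇒≤pred)
open import Data.Nat.DivMod using (_/_; m/n<m; m/n≡1+[m∸n]/n; m*n/n≡m)
open import Data.Nat.Induction using (<-rec)
open import Data.Nat.Tactic.RingSolver using () renaming (solve-∀ to ℕ-solve)
open import Data.Bool using (true; false; if_then_else_)
open import Data.Integer using (0ℤ; -1ℤ)
import Data.Integer.Properties as ℤP
open import Data.Integer.Tactic.RingSolver using () renaming (solve-∀ to ℤ-solve)
import Data.Rational.Properties as ℚP
open import Data.Rational.Unnormalised as ℚᵘ using (mkℚᵘ; *≡*)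
import Data.Rational.Unnormalised.Properties as ℚᵘP
open import Data.Rational.Solver using (module +-*-Solver)
open +-*-Solver using (_:=_; _:+_; _:*_; :-_; con) renaming (solve to ℚ-solve)
open import Data.List using (map; applyUpTo)
open import Data.Vec.Functional using () renaming (_∷_ to _◂_; [] to ◂[])
open import Data.Fin using (Fin) renaming (zero to fzero; suc to fsuc)
open import Data.Product using (_,_; ∃; ∃₂)
open import Data.Sum using (_⊎_; inj₁; inj₂; [_,_]′)
open import Data.Empty using (⊥-elim)
open import Function using (_∘_)
open import Relation.Binary.PropositionalEquality
  using (refl; sym; trans; cong; cong₂; subst; subst₂; module ≡-Reasoning)

double-suc : ∀ m → 2 * suc m ≡ suc (suc (2 * m))
double-suc m = ℕP.*-suc 2 m

half-2+ : ∀ k → (2 + k) / 2 ≡ suc (k / 2)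
half-2+ k = m/n≡1+[m∸n]/n {2 + k} {2} (s≤s (s≤s z≤n))

half-double : ∀ m → 2 * m / 2 ≡ m
half-double m = trans (cong (_/ 2) (ℕP.*-comm 2 m)) (m*n/n≡m m 2)

half-double+1 : ∀ m → suc (2 * m) / 2 ≡ m
half-double+1 zero    = refl
half-double+1 (suc m) =
  trans (cong (λ n → suc n / 2) (double-suc m)) (trans (half-2+ (suc (2 * m))) (cong suc (half-double+1 m)))

half-2+double : ∀ m → (2 + 2 * m) / 2 ≡ suc m
half-2+double m = trans (half-2+ (2 * m)) (cong suc (half-double m))

half-3+double : ∀ m → (3 + 2 * m) / 2 ≡ suc m
half-3+double m = trans (half-2+ (suc (2 * m))) (cong suc (half-double+1 m))

half< : ∀ m → suc m / 2 < suc m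
half< m = m/n<m (suc m) 2 (s≤s (s≤s z≤n))

half-2+≤ : ∀ k → (2 + k) / 2 ≤ suc k
half-2+≤ k = <⇒≤pred (half< (suc k))

-- Here and below we use that isEven (2 + k) reduces to isEven k.
isEven-double : ∀ m → isEven (2 * m) ≡ true
isEven-double zero    = refl
isEven-double (suc m) = trans (cong isEven (double-suc m)) (isEven-double m)

isEven-double+1 : ∀ m → isEven (suc (2 * m)) ≡ false
isEven-double+1 zero    = refl
isEven-double+1 (suc m) = trans (cong (isEven ∘ suc) (double-suc m)) (isEven-double+1 m)

if-true : ∀ {A : Set} {b} {x y : A} → b ≡ true → (if b then x else y) ≡ x
if-true refl = refl

if-false : ∀ {A : Set} {b} {x y : A} → b ≡ false → (if b then x else y) ≡ y
if-false refl = refl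

data Parity : ℕ → Set where
  even : ∀ m → Parity (2 * m)
  odd  : ∀ m → Parity (suc (2 * m))

parity : ∀ n → Parity n
parity zero = even 0
parity (suc n) with parity n
... | even m = odd m
... | odd m  = subst Parity (double-suc m) (even (suc m))

m<1+2m : ∀ m → m < suc (2 * m)
m<1+2m m = s≤s (ℕP.m≤n*m m 2)

1+m<2[1+m] : ∀ m → suc m < 2 * suc m
1+m<2[1+m] m = subst (suc m <_) (sym (double-suc m)) (s≤s (m<1+2m m))

s-go-fuel : ∀ {f g} n → n ≤ f → n ≤ g → s-go f n ≡ s-go g n
s-go-fuel {zero}  {zero}  zero _ _ = refl
s-go-fuel {zero}  {suc _} zero _ _ = refl
s-go-fuel {suc _} {zero}  zero _ _ = refl
s-go-fuel {suc _} {suc _} zero _ _ = refl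
s-go-fuel {suc _} {suc _} (suc zero) _ _ = refl
s-go-fuel {suc f} {suc g} (suc (suc k)) (s≤s p) (s≤s q) with isEven (suc (suc k))
... | true  = s-go-fuel _ (≤-trans (half-2+≤ k) p) (≤-trans (half-2+≤ k) q)
... | false = cong₂ _+_ (s-go-fuel _ (≤-trans (half-2+≤ k) p) (≤-trans (half-2+≤ k) q))
                        (s-go-fuel _ (≤-trans (half< k) p) (≤-trans (half< k) q))

t-go-fuel : ∀ {f g} n → n ≤ f → n ≤ g → t-go f n ≡ t-go g n
t-go-fuel {zero}  {zero}  zero _ _ = refl
t-go-fuel {zero}  {suc _} zero _ _ = refl
t-go-fuel {suc _} {zero}  zero _ _ = refl
t-go-fuel {suc _} {suc _} zero _ _ = refl
t-go-fuel {suc _} {suc _} (suc zero) _ _ = refl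
t-go-fuel {suc f} {suc g} (suc (suc k)) (s≤s p) (s≤s q) with isEven (suc (suc k))
... | true  = cong ℤ.-_ (t-go-fuel _ (≤-trans (half-2+≤ k) p) (≤-trans (half-2+≤ k) q))
... | false = cong₂ (λ a b → ℤ.- a ℤ.- b)
                    (t-go-fuel _ (≤-trans (half-2+≤ k) p) (≤-trans (half-2+≤ k) q))
                    (t-go-fuel _ (≤-trans (half< k) p) (≤-trans (half< k) q))

v2-go-fuel : ∀ {f g} n → n ≤ f → n ≤ g → v2-go f n ≡ v2-go g n
v2-go-fuel {zero}  {zero}  zero _ _ = refl
v2-go-fuel {zero}  {suc _} zero _ _ = refl
v2-go-fuel {suc _} {zero}  zero _ _ = refl
v2-go-fuel {suc _} {suc _} zero _ _ = refl
v2-go-fuel {suc f} {suc g} (suc k) (s≤s p) (s≤s q) with isEven (suc k)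
... | true  = cong suc (v2-go-fuel _ (≤-trans (<⇒≤pred (half< k)) p) (≤-trans (<⇒≤pred (half< k)) q))
... | false = refl

s-unfold : ∀ k → s (2 + k) ≡ (if isEven (2 + k) then s ((2 + k) / 2)
                                else s ((2 + k) / 2) + s (suc (suc k / 2)))
s-unfold k with isEven (2 + k)
... | true  = s-go-fuel _ (half-2+≤ k) ≤-refl
... | false = cong₂ _+_ (s-go-fuel _ (half-2+≤ k) ≤-refl) (s-go-fuel _ (half< k) ≤-refl)

t-unfold : ∀ k → t (2 + k) ≡ (if isEven (2 + k) then ℤ.- t ((2 + k) / 2)
                                else ℤ.- t ((2 + k) / 2) ℤ.- t (suc (suc k / 2)))
t-unfold k with isEven (2 + k)
... | true  = cong ℤ.-_ (t-go-fuel _ (half-2+≤ k) ≤-refl)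
... | false = cong₂ (λ a b → ℤ.- a ℤ.- b) (t-go-fuel _ (half-2+≤ k) ≤-refl) (t-go-fuel _ (half< k) ≤-refl)

v2-unfold : ∀ k → v2 (suc k) ≡ (if isEven (suc k) then suc (v2 (suc k / 2)) else 0)
v2-unfold k with isEven (suc k)
... | true  = cong suc (v2-go-fuel _ (<⇒≤pred (half< k)) ≤-refl)
... | false = refl

s-double : ∀ m → s (2 * m) ≡ s m
s-double zero    = refl
s-double (suc m) = begin
  s (2 * suc m)         ≡⟨ cong s (double-suc m) ⟩
  s (2 + 2 * m)         ≡⟨ s-unfold (2 * m) ⟩
  _                     ≡⟨ if-true (isEven-double m) ⟩
  s ((2 + 2 * m) / 2)   ≡⟨ cong s (half-2+double m) ⟩
  s (suc m)             ∎
  where open ≡-Reasoning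

s-double+1 : ∀ m → s (suc (2 * m)) ≡ s m + s (suc m)
s-double+1 zero    = refl
s-double+1 (suc m) = begin
  s (suc (2 * suc m))
    ≡⟨ cong (s ∘ suc) (double-suc m) ⟩
  s (2 + suc (2 * m))
    ≡⟨ s-unfold (suc (2 * m)) ⟩
  _
    ≡⟨ if-false (isEven-double+1 m) ⟩
  s ((3 + 2 * m) / 2) + s (suc ((2 + 2 * m) / 2))
    ≡⟨ cong₂ (λ a b → s a + s (suc b)) (half-3+double m) (half-2+double m) ⟩
  s (suc m) + s (2 + m) ∎
  where open ≡-Reasoning

t-double : ∀ m → t (2 * m) ≡ ℤ.- t m
t-double zero    = refl
t-double (suc m) = begin
  t (2 * suc m)               ≡⟨ cong t (double-suc m) ⟩
  t (2 + 2 * m)               ≡⟨ t-unfold (2 * m) ⟩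
  _                           ≡⟨ if-true (isEven-double m) ⟩
  ℤ.- t ((2 + 2 * m) / 2)     ≡⟨ cong (ℤ.-_ ∘ t) (half-2+double m) ⟩
  ℤ.- t (suc m)               ∎
  where open ≡-Reasoning

t-double+1 : ∀ m → 1 ≤ m → t (suc (2 * m)) ≡ ℤ.- t m ℤ.- t (suc m)
t-double+1 (suc m) _ = begin
  t (suc (2 * suc m))
    ≡⟨ cong (t ∘ suc) (double-suc m) ⟩
  t (2 + suc (2 * m))
    ≡⟨ t-unfold (suc (2 * m)) ⟩
  _
    ≡⟨ if-false (isEven-double+1 m) ⟩
  ℤ.- t ((3 + 2 * m) / 2) ℤ.- t (suc ((2 + 2 * m) / 2))
    ≡⟨ cong₂ (λ a b → ℤ.- t a ℤ.- t (suc b)) (half-3+double m) (half-2+double m) ⟩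
  ℤ.- t (suc m) ℤ.- t (2 + m) ∎
  where open ≡-Reasoning

v2-double : ∀ m → 1 ≤ m → v2 (2 * m) ≡ suc (v2 m)
v2-double (suc m) _ = begin
  v2 (2 * suc m)             ≡⟨ cong v2 (double-suc m) ⟩
  v2 (2 + 2 * m)             ≡⟨ v2-unfold (suc (2 * m)) ⟩
  _                          ≡⟨ if-true (isEven-double m) ⟩
  suc (v2 ((2 + 2 * m) / 2)) ≡⟨ cong (suc ∘ v2) (half-2+double m) ⟩
  suc (v2 (suc m))           ∎
  where open ≡-Reasoning

v2-double+1 : ∀ m → v2 (suc (2 * m)) ≡ 0
v2-double+1 m = trans (v2-unfold (2 * m)) (if-false (isEven-double+1 m))

ℤtoℚ-+ : ∀ a b → ℤtoℚ (a ℤ.+ b) ≡ ℤtoℚ a ℚ.+ ℤtoℚ b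
ℤtoℚ-+ a b = ℚP.toℚᵘ-injective (begin
  ℚ.toℚᵘ (ℤtoℚ (a ℤ.+ b))               ≈⟨ ℚP.toℚᵘ-fromℚᵘ (mkℚᵘ (a ℤ.+ b) 0) ⟩
  mkℚᵘ (a ℤ.+ b) 0                      ≈⟨ *≡* (cross-multiplied a b) ⟩
  mkℚᵘ a 0 ℚᵘ.+ mkℚᵘ b 0                ≈⟨ ℚᵘP.+-cong (ℚP.toℚᵘ-fromℚᵘ (mkℚᵘ a 0)) (ℚP.toℚᵘ-fromℚᵘ (mkℚᵘ b 0)) ⟨
  ℚ.toℚᵘ (ℤtoℚ a) ℚᵘ.+ ℚ.toℚᵘ (ℤtoℚ b)  ≈⟨ ℚP.toℚᵘ-homo-+ (ℤtoℚ a) (ℤtoℚ b) ⟨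
  ℚ.toℚᵘ (ℤtoℚ a ℚ.+ ℤtoℚ b)            ∎)
  where
  open ℚᵘP.≃-Reasoning
  cross-multiplied : ∀ a b → (a ℤ.+ b) ℤ.* + 1 ≡ (a ℤ.* + 1 ℤ.+ b ℤ.* + 1) ℤ.* + 1
  cross-multiplied = ℤ-solve

ℕtoℚ-+ : ∀ a b → ℕtoℚ (a + b) ≡ ℕtoℚ a ℚ.+ ℕtoℚ b
ℕtoℚ-+ a b = trans (cong ℤtoℚ (ℤP.pos-+ a b)) (ℤtoℚ-+ (+ a) (+ b))

divℤ-cancelʳ : ∀ a d → d ≢ 0ℤ → divℤ (a ℤ.* d) d ≡ ℤtoℚ a
divℤ-cancelʳ a (+ zero)   d≢0 = ⊥-elim (d≢0 refl)
divℤ-cancelʳ a (+ suc d)  _   = ℚP.fromℚᵘ-cong {mkℚᵘ (a ℤ.* + suc d) d} {mkℚᵘ a 0} (*≡* (ℤP.*-identityʳ _))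
divℤ-cancelʳ a ℤ.-[1+ d ] _   =
  ℚP.fromℚᵘ-cong {mkℚᵘ (ℤ.- (a ℤ.* ℤ.-[1+ d ])) d} {mkℚᵘ a 0} (*≡* (cross-multiplied a (+ suc d)))
  where
  cross-multiplied : ∀ a d → (ℤ.- (a ℤ.* ℤ.- d)) ℤ.* + 1 ≡ a ℤ.* d
  cross-multiplied = ℤ-solve

pos≢0 : ∀ {n} → 0 < n → + n ≢ 0ℤ
pos≢0 {suc n} _ ()

-- The Stern sequence

0<s[1+n] : ∀ n → 0 < s (suc n)
0<s[1+n] = <-rec _ step
  where
  step : ∀ n → (∀ {m} → m < n → 0 < s (suc m)) → 0 < s (suc n)
  step n rec with parity n
  ... | even zero    = s≤s z≤n
  ... | even (suc m) = subst (0 <_) (sym (s-double+1 (suc m)))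
                         (ℕP.<-≤-trans (rec (1+m<2[1+m] m)) (ℕP.m≤n+m _ (s (suc m))))
  ... | odd m        = subst (0 <_) (sym (trans (cong s (sym (double-suc m))) (s-double (suc m))))
                         (rec (m<1+2m m))

s-neighbourSum : ∀ n → s n + s (2 + n) ≡ (1 + 2 * v2 (suc n)) * s (suc n)
s-neighbourSum = <-rec _ step
  where
  step : ∀ n → (∀ {m} → m < n → s m + s (2 + m) ≡ (1 + 2 * v2 (suc m)) * s (suc m)) →
         s n + s (2 + n) ≡ (1 + 2 * v2 (suc n)) * s (suc n)
  step n rec with parity n
  ... | even m = begin
    s (2 * m) + s (2 + 2 * m)
      ≡⟨ cong₂ _+_ (s-double m) (trans (cong s (sym (double-suc m))) (s-double (suc m))) ⟩
    s m + s (suc m)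
      ≡⟨ sym (s-double+1 m) ⟩
    s (suc (2 * m))
      ≡⟨ sym (ℕP.*-identityˡ _) ⟩
    1 * s (suc (2 * m))
      ≡⟨ cong (λ v → (1 + 2 * v) * s (suc (2 * m))) (sym (v2-double+1 m)) ⟩
    (1 + 2 * v2 (suc (2 * m))) * s (suc (2 * m)) ∎
    where open ≡-Reasoning
  ... | odd m = begin
    s (suc (2 * m)) + s (3 + 2 * m)
      ≡⟨ cong (λ k → s (suc (2 * m)) + s (suc k)) (sym (double-suc m)) ⟩
    s (suc (2 * m)) + s (suc (2 * suc m))
      ≡⟨ cong₂ _+_ (s-double+1 m) (s-double+1 (suc m)) ⟩
    (s m + s (suc m)) + (s (suc m) + s (2 + m))
      ≡⟨ regroup (s m) (s (suc m)) (s (2 + m)) ⟩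
    (s m + s (2 + m)) + 2 * s (suc m)
      ≡⟨ cong (_+ 2 * s (suc m)) (rec (m<1+2m m)) ⟩
    (1 + 2 * v2 (suc m)) * s (suc m) + 2 * s (suc m)
      ≡⟨ absorb (v2 (suc m)) (s (suc m)) ⟩
    (1 + 2 * suc (v2 (suc m))) * s (suc m)
      ≡⟨ cong₂ (λ v a → (1 + 2 * v) * a) (sym (v2-double (suc m) (s≤s z≤n))) (sym (s-double (suc m))) ⟩
    (1 + 2 * v2 (2 * suc m)) * s (2 * suc m)
      ≡⟨ cong (λ k → (1 + 2 * v2 k) * s k) (double-suc m) ⟩
    (1 + 2 * v2 (2 + 2 * m)) * s (2 + 2 * m) ∎
    where
    open ≡-Reasoning
    regroup : ∀ a b c → (a + b) + (b + c) ≡ (a + c) + 2 * b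
    regroup = ℕ-solve
    absorb : ∀ v a → (1 + 2 * v) * a + 2 * a ≡ (1 + 2 * suc v) * a
    absorb = ℕ-solve

sRatio-suc : ∀ m → sRatio (suc m) ≡ ℕtoℚ (1 + 2 * v2 (suc m))
sRatio-suc m = begin
  divℤ (+ (s m + s (2 + m))) (+ s (suc m))          ≡⟨ cong (λ a → divℤ (+ a) (+ s (suc m))) (s-neighbourSum m) ⟩
  divℤ (+ (r * s (suc m))) (+ s (suc m))            ≡⟨ cong (λ a → divℤ a (+ s (suc m))) (ℤP.pos-* r (s (suc m))) ⟩
  divℤ (+ r ℤ.* + s (suc m)) (+ s (suc m))          ≡⟨ divℤ-cancelʳ (+ r) (+ s (suc m)) (pos≢0 (0<s[1+n] m)) ⟩
  ℕtoℚ r                                            ∎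
  where
  open ≡-Reasoning
  r : ℕ
  r = 1 + 2 * v2 (suc m)

stern-ratio : ∀ n → 1 ≤ n → (s n ℕD.∣ (s (n ∸ 1) + s (suc n))) × (sRatio n ≡ ℕtoℚ (1 + 2 * v2 n))
stern-ratio (suc m) _ = ℕD.divides (1 + 2 * v2 (suc m)) (s-neighbourSum m) , sRatio-suc m

-- The series C

Cser-double+1 : ∀ m → Cser (suc (2 * m)) ≡ ℚ.1ℚ
Cser-double+1 m = trans (sRatio-suc (2 * m)) (cong (λ v → ℕtoℚ (1 + 2 * v)) (v2-double+1 m))

Cser-double : ∀ m → Cser (2 * suc m) ≡ Cser (suc m) ℚ.+ ℕtoℚ 2
Cser-double m = begin
  Cser (2 * suc m)                        ≡⟨ cong Cser (double-suc m) ⟩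
  sRatio (2 + 2 * m)                      ≡⟨ sRatio-suc (suc (2 * m)) ⟩
  ℕtoℚ (1 + 2 * v2 (2 + 2 * m))           ≡⟨ cong (λ k → ℕtoℚ (1 + 2 * v2 k)) (sym (double-suc m)) ⟩
  ℕtoℚ (1 + 2 * v2 (2 * suc m))           ≡⟨ cong (λ v → ℕtoℚ (1 + 2 * v)) (v2-double (suc m) (s≤s z≤n)) ⟩
  ℕtoℚ (1 + 2 * suc v)                    ≡⟨ cong ℕtoℚ (shift v) ⟩
  ℕtoℚ ((1 + 2 * v) + 2)                  ≡⟨ ℕtoℚ-+ (1 + 2 * v) 2 ⟩
  ℕtoℚ (1 + 2 * v) ℚ.+ ℕtoℚ 2             ≡⟨ cong (ℚ._+ ℕtoℚ 2) (sym (sRatio-suc m)) ⟩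
  Cser (suc m) ℚ.+ ℕtoℚ 2                 ∎
  where
  open ≡-Reasoning
  v : ℕ
  v = v2 (suc m)
  shift : ∀ v → 1 + 2 * suc v ≡ (1 + 2 * v) + 2
  shift = ℕ-solve

Δ : PS
Δ = Cser -PS atZ² Cser

Δ-double+1 : ∀ m → Δ (suc (2 * m)) ≡ ℚ.1ℚ
Δ-double+1 m = cong₂ ℚ._-_ (Cser-double+1 m) (if-false (isEven-double+1 m))

Δ-double : ∀ m → Δ (2 * suc m) ≡ ℕtoℚ 2
Δ-double m = begin
  Cser (2 * suc m) ℚ.- atZ² Cser (2 * suc m)
    ≡⟨ cong₂ ℚ._-_ (Cser-double m) Cser[z²]-double ⟩
  (Cser (suc m) ℚ.+ ℕtoℚ 2) ℚ.- Cser (suc m)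
    ≡⟨ ℚ-solve 2 (λ c d → (c :+ d) :+ (:- c) := d) refl (Cser (suc m)) (ℕtoℚ 2) ⟩
  ℕtoℚ 2 ∎
  where
  open ≡-Reasoning
  Cser[z²]-double : atZ² Cser (2 * suc m) ≡ Cser (suc m)
  Cser[z²]-double = trans (if-true (isEven-double (suc m))) (cong Cser (half-double (suc m)))

Δ-period : ∀ k → Δ (3 + k) ≡ Δ (suc k)
Δ-period k with parity k
... | even m = begin
  Δ (3 + 2 * m)        ≡⟨ cong (Δ ∘ suc) (sym (double-suc m)) ⟩
  Δ (suc (2 * suc m))  ≡⟨ Δ-double+1 (suc m) ⟩
  ℚ.1ℚ                 ≡⟨ Δ-double+1 m ⟨
  Δ (suc (2 * m))      ∎
  where open ≡-Reasoning
... | odd m = begin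
  Δ (4 + 2 * m)        ≡⟨ cong (Δ ∘ suc ∘ suc) (sym (double-suc m)) ⟩
  Δ (2 + 2 * suc m)    ≡⟨ cong Δ (sym (double-suc (suc m))) ⟩
  Δ (2 * suc (suc m))  ≡⟨ Δ-double (suc m) ⟩
  ℕtoℚ 2               ≡⟨ Δ-double m ⟨
  Δ (2 * suc m)        ≡⟨ cong Δ (double-suc m) ⟩
  Δ (2 + 2 * m)        ∎
  where open ≡-Reasoning

sumℚ-map-applyUpTo-zero : ∀ (f : ℕ → ℚ) (g : ℕ → ℕ) k → (∀ i → f (g i) ≡ ℚ.0ℚ) →
                          sumℚ (map f (applyUpTo g k)) ≡ ℚ.0ℚ
sumℚ-map-applyUpTo-zero f g zero    _ = refl
sumℚ-map-applyUpTo-zero f g (suc k) h =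
  cong₂ ℚ._+_ (h 0) (sumℚ-map-applyUpTo-zero f (g ∘ suc) k (h ∘ suc))

*PS-quadratic : ∀ a b c A k → (poly (a ∷ b ∷ c ∷ []) *PS A) (2 + k) ≡
                a ℚ.* A (2 + k) ℚ.+ (b ℚ.* A (suc k) ℚ.+ (c ℚ.* A k ℚ.+ ℚ.0ℚ))
*PS-quadratic a b c A k =
  cong (λ r → a ℚ.* A (2 + k) ℚ.+ (b ℚ.* A (suc k) ℚ.+ (c ℚ.* A k ℚ.+ r)))
       (sumℚ-map-applyUpTo-zero _ _ k (λ i → ℚP.*-zeroˡ (A (k ∸ suc i))))

Cser-functional-equation : (poly (ℚ.1ℚ ∷ ℚ.0ℚ ∷ ℚ.- ℚ.1ℚ ∷ []) *PS Δ) ≈PS poly (ℚ.0ℚ ∷ ℚ.1ℚ ∷ ℕtoℚ 2 ∷ [])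
Cser-functional-equation zero                = refl
Cser-functional-equation (suc zero)          = refl
Cser-functional-equation (suc (suc zero))    = refl
Cser-functional-equation (suc (suc (suc k))) =
  trans (*PS-quadratic ℚ.1ℚ ℚ.0ℚ (ℚ.- ℚ.1ℚ) Δ (suc k)) (cancel {y = Δ (2 + k)} (Δ-period k))
  where
  cancel : ∀ {x x′ y} → x ≡ x′ → ℚ.1ℚ ℚ.* x ℚ.+ (ℚ.0ℚ ℚ.* y ℚ.+ (ℚ.- ℚ.1ℚ ℚ.* x′ ℚ.+ ℚ.0ℚ)) ≡ ℚ.0ℚ
  cancel {x} {y = y} refl =
    ℚ-solve 2 (λ x y → con ℚ.1ℚ :* x :+ (con ℚ.0ℚ :* y :+ (con (ℚ.- ℚ.1ℚ) :* x :+ con ℚ.0ℚ)) := con ℚ.0ℚ) refl x y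

inSpan₃ : ∀ {A B₀ B₁ B₂} a b c → (∀ n → A n ≡ a ℚ.* B₀ n ℚ.+ (b ℚ.* B₁ n ℚ.+ c ℚ.* B₂ n)) →
          InSpan A 3 (B₀ ◂ B₁ ◂ B₂ ◂ ◂[])
inSpan₃ {B₀ = B₀} {B₁} {B₂} a b c eq =
  (a ◂ b ◂ c ◂ ◂[]) ,
  λ n → trans (eq n) (cong (λ x → a ℚ.* B₀ n ℚ.+ (b ℚ.* B₁ n ℚ.+ x)) (sym (ℚP.+-identityʳ (c ℚ.* B₂ n))))

ones δ₀ : PS
ones _ = ℚ.1ℚ
δ₀ = poly (ℚ.1ℚ ∷ [])

Cser-double-δ₀ : ∀ n → Cser (2 * n) ≡ ℚ.1ℚ ℚ.* Cser n ℚ.+ ℕtoℚ 2 ℚ.+ (ℚ.- ℕtoℚ 2) ℚ.* δ₀ n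
Cser-double-δ₀ zero    = refl
Cser-double-δ₀ (suc m) = trans (Cser-double m) (drop-δ₀ (Cser (suc m)) (ℕtoℚ 2))
  where
  drop-δ₀ : ∀ c d → c ℚ.+ d ≡ ℚ.1ℚ ℚ.* c ℚ.+ d ℚ.+ (ℚ.- d) ℚ.* ℚ.0ℚ
  drop-δ₀ = ℚ-solve 2 (λ c d → c :+ d := con ℚ.1ℚ :* c :+ d :+ (:- d) :* con ℚ.0ℚ) refl

δ₀-double : ∀ n → δ₀ (2 * n) ≡ δ₀ n
δ₀-double zero    = refl
δ₀-double (suc n) = refl

Cser-twoRegular : TwoRegular Cser
Cser-twoRegular = 3 , basis , inBasis ℚ.1ℚ ℚ.0ℚ ℚ.0ℚ (λ n → itself (Cser n) (δ₀ n)) , stable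
  where
  basis : Fin 3 → PS
  basis = Cser ◂ ones ◂ δ₀ ◂ ◂[]

  inBasis : ∀ {A} a b c → (∀ n → A n ≡ a ℚ.* Cser n ℚ.+ b ℚ.+ c ℚ.* δ₀ n) → InSpan A 3 basis
  inBasis a b c eq = inSpan₃ a b c λ n → trans (eq n) (regroup a b c (Cser n) (δ₀ n))
    where
    regroup : ∀ a b c x z → a ℚ.* x ℚ.+ b ℚ.+ c ℚ.* z ≡ a ℚ.* x ℚ.+ (b ℚ.* ℚ.1ℚ ℚ.+ c ℚ.* z)
    regroup = ℚ-solve 5 (λ a b c x z → a :* x :+ b :+ c :* z := a :* x :+ (b :* con ℚ.1ℚ :+ c :* z)) refl

  itself : ∀ x z → x ≡ ℚ.1ℚ ℚ.* x ℚ.+ ℚ.0ℚ ℚ.+ ℚ.0ℚ ℚ.* z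
  itself = ℚ-solve 2 (λ x z → x := con ℚ.1ℚ :* x :+ con ℚ.0ℚ :+ con ℚ.0ℚ :* z) refl

  constant : ∀ b x z → b ≡ ℚ.0ℚ ℚ.* x ℚ.+ b ℚ.+ ℚ.0ℚ ℚ.* z
  constant = ℚ-solve 3 (λ b x z → b := con ℚ.0ℚ :* x :+ b :+ con ℚ.0ℚ :* z) refl

  δ₀-itself : ∀ x z → z ≡ ℚ.0ℚ ℚ.* x ℚ.+ ℚ.0ℚ ℚ.+ ℚ.1ℚ ℚ.* z
  δ₀-itself = ℚ-solve 2 (λ x z → z := con ℚ.0ℚ :* x :+ con ℚ.0ℚ :+ con ℚ.1ℚ :* z) refl

  stable : ∀ i j → InSpan (ρ i (basis j)) 3 basis
  stable fzero       fzero               = inBasis ℚ.1ℚ (ℕtoℚ 2) (ℚ.- ℕtoℚ 2) Cser-double-δ₀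
  stable (fsuc fzero) fzero              = inBasis ℚ.0ℚ ℚ.1ℚ ℚ.0ℚ λ n →
    trans (Cser-double+1 n) (constant ℚ.1ℚ (Cser n) (δ₀ n))
  stable _           (fsuc fzero)        = inBasis ℚ.0ℚ ℚ.1ℚ ℚ.0ℚ λ n → constant ℚ.1ℚ (Cser n) (δ₀ n)
  stable fzero       (fsuc (fsuc fzero)) = inBasis ℚ.0ℚ ℚ.0ℚ ℚ.1ℚ λ n →
    trans (δ₀-double n) (δ₀-itself (Cser n) (δ₀ n))
  stable (fsuc fzero) (fsuc (fsuc fzero)) = inBasis ℚ.0ℚ ℚ.0ℚ ℚ.0ℚ λ n → constant ℚ.0ℚ (Cser n) (δ₀ n)

*2^-suc : ∀ a k → a * 2 ^ suc k ≡ 2 * (a * 2 ^ k)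
*2^-suc a k = commute a (2 ^ k)
  where
  commute : ∀ a x → a * (2 * x) ≡ 2 * (a * x)
  commute = ℕ-solve

≤*2^ : ∀ a k → a ≤ a * 2 ^ k
≤*2^ a k = ℕP.m≤m*n a (2 ^ k) {{ℕP.m^n≢0 2 k}}

odd*2^-decomposition : ∀ n → 1 ≤ n → ∃₂ λ m k → n ≡ suc (2 * m) * 2 ^ k
odd*2^-decomposition = <-rec _ step
  where
  step : ∀ n → (∀ {n′} → n′ < n → 1 ≤ n′ → ∃₂ λ m k → n′ ≡ suc (2 * m) * 2 ^ k) →
         1 ≤ n → ∃₂ λ m k → n ≡ suc (2 * m) * 2 ^ k
  step n rec 1≤n with parity n
  ... | odd m        = m , 0 , sym (ℕP.*-identityʳ (suc (2 * m)))
  ... | even (suc m) with rec (1+m<2[1+m] m) (s≤s z≤n)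
  ...   | o , k , eq = o , suc k , trans (cong (2 *_) eq) (sym (*2^-suc (suc (2 * o)) k))
  step n rec () | even zero

v2-odd*2^ : ∀ m k → v2 (suc (2 * m) * 2 ^ k) ≡ k
v2-odd*2^ m zero    = trans (cong v2 (ℕP.*-identityʳ (suc (2 * m)))) (v2-double+1 m)
v2-odd*2^ m (suc k) = begin
  v2 (suc (2 * m) * 2 ^ suc k)    ≡⟨ cong v2 (*2^-suc (suc (2 * m)) k) ⟩
  v2 (2 * (suc (2 * m) * 2 ^ k))  ≡⟨ v2-double _ (≤-trans (s≤s z≤n) (≤*2^ (suc (2 * m)) k)) ⟩
  suc (v2 (suc (2 * m) * 2 ^ k))  ≡⟨ cong suc (v2-odd*2^ m k) ⟩
  suc k                           ∎
  where open ≡-Reasoning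

-- Neighbour sums of the twisted Stern sequence

tNeighbourSum : ℕ → ℤ
tNeighbourSum n = t (n ∸ 1) ℤ.+ t (suc n)

tNeighbourSum-double+1 : ∀ m → 1 ≤ m → tNeighbourSum (suc (2 * m)) ≡ t (suc (2 * m))
tNeighbourSum-double+1 m 1≤m = begin
  t (2 * m) ℤ.+ t (2 + 2 * m)     ≡⟨ cong₂ ℤ._+_ (t-double m) (trans (cong t (sym (double-suc m))) (t-double (suc m))) ⟩
  ℤ.- t m ℤ.- t (suc m)           ≡⟨ t-double+1 m 1≤m ⟨
  t (suc (2 * m))                 ∎
  where open ≡-Reasoning

tNeighbourSum-double : ∀ m → 2 ≤ m → tNeighbourSum (2 * m) ≡ ℤ.- tNeighbourSum m ℤ.- + 2 ℤ.* t m
tNeighbourSum-double (suc zero) (s≤s ())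
tNeighbourSum-double (suc (suc k)) _ = begin
  t (2 * suc (suc k) ∸ 1) ℤ.+ t (suc (2 * suc (suc k)))
    ≡⟨ cong (λ n → t (n ∸ 1) ℤ.+ t (suc (2 * suc (suc k)))) (double-suc (suc k)) ⟩
  t (suc (2 * suc k)) ℤ.+ t (suc (2 * suc (suc k)))
    ≡⟨ cong₂ ℤ._+_ (t-double+1 (suc k) (s≤s z≤n)) (t-double+1 (suc (suc k)) (s≤s z≤n)) ⟩
  (ℤ.- t (suc k) ℤ.- t (2 + k)) ℤ.+ (ℤ.- t (2 + k) ℤ.- t (3 + k))
    ≡⟨ regroup (t (suc k)) (t (2 + k)) (t (3 + k)) ⟩
  ℤ.- (t (suc k) ℤ.+ t (3 + k)) ℤ.- + 2 ℤ.* t (2 + k) ∎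
  where
  open ≡-Reasoning
  regroup : ∀ a b c → (ℤ.- a ℤ.- b) ℤ.+ (ℤ.- b ℤ.- c) ≡ ℤ.- (a ℤ.+ c) ℤ.- + 2 ℤ.* b
  regroup = ℤ-solve

tNeighbourSum-ratio-double : ∀ {m} R → 2 ≤ m → tNeighbourSum m ≡ R ℤ.* t m →
                             tNeighbourSum (2 * m) ≡ (R ℤ.+ + 2) ℤ.* t (2 * m)
tNeighbourSum-ratio-double {m} R 2≤m eq = begin
  tNeighbourSum (2 * m)                 ≡⟨ tNeighbourSum-double m 2≤m ⟩
  ℤ.- tNeighbourSum m ℤ.- + 2 ℤ.* t m   ≡⟨ cong (λ x → ℤ.- x ℤ.- + 2 ℤ.* t m) eq ⟩
  ℤ.- (R ℤ.* t m) ℤ.- + 2 ℤ.* t m       ≡⟨ factor R (t m) ⟩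
  (R ℤ.+ + 2) ℤ.* ℤ.- t m               ≡⟨ cong ((R ℤ.+ + 2) ℤ.*_) (t-double m) ⟨
  (R ℤ.+ + 2) ℤ.* t (2 * m)             ∎
  where
  open ≡-Reasoning
  factor : ∀ r x → ℤ.- (r ℤ.* x) ℤ.- + 2 ℤ.* x ≡ (r ℤ.+ + 2) ℤ.* ℤ.- x
  factor = ℤ-solve

tNeighbourSum-ratio-*2^ : ∀ {a} R → 2 ≤ a → tNeighbourSum a ≡ R ℤ.* t a →
                          ∀ k → tNeighbourSum (a * 2 ^ k) ≡ (R ℤ.+ + 2 ℤ.* + k) ℤ.* t (a * 2 ^ k)
tNeighbourSum-ratio-*2^ {a} R _ eq zero = begin
  tNeighbourSum (a * 1)        ≡⟨ cong tNeighbourSum (ℕP.*-identityʳ a) ⟩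
  tNeighbourSum a              ≡⟨ eq ⟩
  R ℤ.* t a                    ≡⟨ cong₂ (λ r n → r ℤ.* t n) (sym (ℤP.+-identityʳ R)) (sym (ℕP.*-identityʳ a)) ⟩
  (R ℤ.+ 0ℤ) ℤ.* t (a * 1)     ∎
  where open ≡-Reasoning
tNeighbourSum-ratio-*2^ {a} R 2≤a eq (suc k) = begin
  tNeighbourSum (a * 2 ^ suc k)
    ≡⟨ cong tNeighbourSum (*2^-suc a k) ⟩
  tNeighbourSum (2 * (a * 2 ^ k))
    ≡⟨ tNeighbourSum-ratio-double (R ℤ.+ + 2 ℤ.* + k) (≤-trans 2≤a (≤*2^ a k)) (tNeighbourSum-ratio-*2^ R 2≤a eq k) ⟩
  (R ℤ.+ + 2 ℤ.* + k ℤ.+ + 2) ℤ.* t (2 * (a * 2 ^ k))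
    ≡⟨ cong₂ (λ r n → r ℤ.* t n) (step R (+ k)) (sym (*2^-suc a k)) ⟩
  (R ℤ.+ + 2 ℤ.* + suc k) ℤ.* t (a * 2 ^ suc k) ∎
  where
  open ≡-Reasoning
  step : ∀ r x → r ℤ.+ + 2 ℤ.* x ℤ.+ + 2 ≡ r ℤ.+ + 2 ℤ.* (+ 1 ℤ.+ x)
  step = ℤ-solve

t-3*2^ : ∀ k → t (3 * 2 ^ k) ≡ 0ℤ
t-3*2^ zero    = refl
t-3*2^ (suc k) = trans (cong t (*2^-suc 3 k)) (trans (t-double (3 * 2 ^ k)) (cong ℤ.-_ (t-3*2^ k)))

tNeighbourSum-3*2^ : ∀ k → tNeighbourSum (3 * 2 ^ k) ≡ 0ℤ
tNeighbourSum-3*2^ k = begin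
  tNeighbourSum (3 * 2 ^ k)                       ≡⟨ tNeighbourSum-ratio-*2^ {3} 0ℤ (s≤s (s≤s z≤n)) refl k ⟩
  (0ℤ ℤ.+ + 2 ℤ.* + k) ℤ.* t (3 * 2 ^ k)          ≡⟨ cong ((0ℤ ℤ.+ + 2 ℤ.* + k) ℤ.*_) (t-3*2^ k) ⟩
  (0ℤ ℤ.+ + 2 ℤ.* + k) ℤ.* 0ℤ                     ≡⟨ ℤP.*-zeroʳ (0ℤ ℤ.+ + 2 ℤ.* + k) ⟩
  0ℤ                                              ∎
  where open ≡-Reasoning

tNeighbourSum-2^ : ∀ e → 1 ≤ e → tNeighbourSum (2 ^ e) ≡ (+ 1 ℤ.+ + 2 ℤ.* (+ e ℤ.- + 2)) ℤ.* t (2 ^ e)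
tNeighbourSum-2^ (suc k) _ =
  trans (tNeighbourSum-ratio-*2^ {2} -1ℤ (s≤s (s≤s z≤n)) refl k) (cong (ℤ._* t (2 ^ suc k)) (shift (+ k)))
  where
  shift : ∀ x → -1ℤ ℤ.+ + 2 ℤ.* x ≡ + 1 ℤ.+ + 2 ℤ.* ((+ 1 ℤ.+ x) ℤ.- + 2)
  shift = ℤ-solve

tNeighbourSum-odd*2^ : ∀ m k → tNeighbourSum (suc (2 * suc m) * 2 ^ k) ≡
                                (+ 1 ℤ.+ + 2 ℤ.* + k) ℤ.* t (suc (2 * suc m) * 2 ^ k)
tNeighbourSum-odd*2^ m = tNeighbourSum-ratio-*2^ {a} (+ 1) (s≤s (s≤s z≤n)) odd-base
  where
  a : ℕ
  a = suc (2 * suc m)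
  odd-base : tNeighbourSum a ≡ + 1 ℤ.* t a
  odd-base = trans (tNeighbourSum-double+1 (suc m) (s≤s z≤n)) (sym (ℤP.*-identityˡ (t a)))

1+2x≢0 : ∀ x → + 1 ℤ.+ + 2 ℤ.* x ≢ 0ℤ
1+2x≢0 x 1+2x≡0 = ℕP.even≢odd ℤ.∣ x ∣ 0 (trans (sym (ℤP.abs-* (+ 2) x)) (cong ℤ.∣_∣ 2x≡-1))
  where
  2x≡-1 : + 2 ℤ.* x ≡ -1ℤ
  2x≡-1 = trans (isolate x) (cong (ℤ._+ -1ℤ) 1+2x≡0)
    where
    isolate : ∀ x → + 2 ℤ.* x ≡ (+ 1 ℤ.+ + 2 ℤ.* x) ℤ.+ -1ℤ
    isolate = ℤ-solve

tNeighbourSum-odd-multiple : ∀ n → 1 ≤ n → ∃ λ x → tNeighbourSum n ≡ (+ 1 ℤ.+ + 2 ℤ.* x) ℤ.* t n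
tNeighbourSum-odd-multiple n 1≤n with odd*2^-decomposition n 1≤n
... | suc m , k     , refl = + k , tNeighbourSum-odd*2^ m k
... | zero  , zero  , refl = -1ℤ , refl
... | zero  , suc k , refl =
  + suc k ℤ.- + 2 ,
  subst (λ n → tNeighbourSum n ≡ (+ 1 ℤ.+ + 2 ℤ.* (+ suc k ℤ.- + 2)) ℤ.* t n)
        (sym (ℕP.*-identityˡ (2 ^ suc k))) (tNeighbourSum-2^ (suc k) (s≤s z≤n))

-- Zeros of the twisted Stern sequence

IsUnit : ℤ → Set
IsUnit ε = ε ≡ + 1 ⊎ ε ≡ -1ℤ

IsUnit-neg : ∀ {ε} → IsUnit ε → IsUnit (ℤ.- ε)
IsUnit-neg (inj₁ refl) = inj₂ refl
IsUnit-neg (inj₂ refl) = inj₁ refl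

IsUnit⇒≢0 : ∀ {ε} → IsUnit ε → ε ≢ 0ℤ
IsUnit⇒≢0 (inj₁ refl) ()
IsUnit⇒≢0 (inj₂ refl) ()

t-2^-unit : ∀ e → IsUnit (t (2 ^ e))
t-2^-unit zero    = inj₁ refl
t-2^-unit (suc e) = subst IsUnit (sym (t-double (2 ^ e))) (IsUnit-neg (t-2^-unit e))

-- Two integers of the same (weak) sign that are not both zero.
record Concordant (a b : ℤ) : Set where
  field
    sign     : ℤ
    unit     : IsUnit sign
    ∣a∣ ∣b∣  : ℕ
    positive : 0 < ∣a∣ + ∣b∣
    a≡       : a ≡ sign ℤ.* + ∣a∣
    b≡       : b ≡ sign ℤ.* + ∣b∣

concordant-+≢0 : ∀ {a b} → Concordant a b → a ℤ.+ b ≢ 0ℤ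
concordant-+≢0 {a} {b} c a+b≡0 =
  [ IsUnit⇒≢0 unit , pos≢0 positive ]′ (ℤP.i*j≡0⇒i≡0∨j≡0 sign sign*[∣a∣+∣b∣]≡0)
  where
  open Concordant c
  open ≡-Reasoning
  sign*[∣a∣+∣b∣]≡0 : sign ℤ.* + (∣a∣ + ∣b∣) ≡ 0ℤ
  sign*[∣a∣+∣b∣]≡0 = begin
    sign ℤ.* + (∣a∣ + ∣b∣)             ≡⟨ cong (sign ℤ.*_) (ℤP.pos-+ ∣a∣ ∣b∣) ⟩
    sign ℤ.* (+ ∣a∣ ℤ.+ + ∣b∣)         ≡⟨ ℤP.*-distribˡ-+ sign (+ ∣a∣) (+ ∣b∣) ⟩
    sign ℤ.* + ∣a∣ ℤ.+ sign ℤ.* + ∣b∣  ≡⟨ cong₂ ℤ._+_ a≡ b≡ ⟨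
    a ℤ.+ b                            ≡⟨ a+b≡0 ⟩
    0ℤ                                 ∎

-[εx]-εy≡-ε[x+y] : ∀ ε x y → ℤ.- (ε ℤ.* + x) ℤ.- ε ℤ.* + y ≡ ℤ.- ε ℤ.* + (x + y)
-[εx]-εy≡-ε[x+y] ε x y = trans (factor ε (+ x) (+ y)) (cong (ℤ.- ε ℤ.*_) (sym (ℤP.pos-+ x y)))
  where
  factor : ∀ e x y → ℤ.- (e ℤ.* x) ℤ.- e ℤ.* y ≡ ℤ.- e ℤ.* (x ℤ.+ y)
  factor = ℤ-solve

concordant-left : ∀ {a b} → Concordant a b → Concordant (ℤ.- a) (ℤ.- a ℤ.- b)
concordant-left c = record
  { sign     = ℤ.- sign
  ; unit     = IsUnit-neg unit
  ; ∣a∣      = ∣a∣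
  ; ∣b∣      = ∣a∣ + ∣b∣
  ; positive = ℕP.<-≤-trans positive (ℕP.m≤n+m (∣a∣ + ∣b∣) ∣a∣)
  ; a≡       = trans (cong ℤ.-_ a≡) (ℤP.neg-distribˡ-* sign (+ ∣a∣))
  ; b≡       = trans (cong₂ (λ x y → ℤ.- x ℤ.- y) a≡ b≡) (-[εx]-εy≡-ε[x+y] sign ∣a∣ ∣b∣)
  }
  where open Concordant c

concordant-right : ∀ {a b} → Concordant a b → Concordant (ℤ.- a ℤ.- b) (ℤ.- b)
concordant-right c = record
  { sign     = ℤ.- sign
  ; unit     = IsUnit-neg unit
  ; ∣a∣      = ∣a∣ + ∣b∣
  ; ∣b∣      = ∣b∣
  ; positive = ℕP.<-≤-trans positive (ℕP.m≤m+n (∣a∣ + ∣b∣) ∣b∣)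
  ; a≡       = trans (cong₂ (λ x y → ℤ.- x ℤ.- y) a≡ b≡) (-[εx]-εy≡-ε[x+y] sign ∣a∣ ∣b∣)
  ; b≡       = trans (cong ℤ.-_ b≡) (ℤP.neg-distribˡ-* sign (+ ∣b∣))
  }
  where open Concordant c

t-concordant : ∀ m → 2 ≤ m → Concordant (t m) (t (suc m))
t-concordant = <-rec _ step
  where
  step : ∀ m → (∀ {k} → k < m → 2 ≤ k → Concordant (t k) (t (suc k))) → 2 ≤ m → Concordant (t m) (t (suc m))
  step m rec 2≤m with parity m
  ... | even (suc zero) =
    record { sign = -1ℤ ; unit = inj₂ refl ; ∣a∣ = 1 ; ∣b∣ = 0 ; positive = s≤s z≤n ; a≡ = refl ; b≡ = refl }
  ... | odd (suc zero) =
    record { sign = + 1 ; unit = inj₁ refl ; ∣a∣ = 0 ; ∣b∣ = 1 ; positive = s≤s z≤n ; a≡ = refl ; b≡ = refl }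
  ... | even (suc (suc k)) =
    subst₂ Concordant (sym (t-double (2 + k))) (sym (t-double+1 (2 + k) (s≤s z≤n)))
      (concordant-left (rec (1+m<2[1+m] (suc k)) (s≤s (s≤s z≤n))))
  ... | odd (suc (suc k)) =
    subst₂ Concordant (sym (t-double+1 (2 + k) (s≤s z≤n)))
      (sym (trans (cong t (sym (double-suc (2 + k)))) (t-double (3 + k))))
      (concordant-right (rec (m<1+2m (2 + k)) (s≤s (s≤s z≤n))))
  step m rec () | even zero
  step m rec (s≤s ()) | odd zero

t≡0⇒3*2^ : ∀ n → 1 ≤ n → t n ≡ 0ℤ → ∃ λ k → n ≡ 3 * 2 ^ k
t≡0⇒3*2^ = <-rec _ step
  where
  step : ∀ n → (∀ {m} → m < n → 1 ≤ m → t m ≡ 0ℤ → ∃ λ k → m ≡ 3 * 2 ^ k) →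
         1 ≤ n → t n ≡ 0ℤ → ∃ λ k → n ≡ 3 * 2 ^ k
  step n rec 1≤n tn≡0 with parity n
  ... | odd (suc zero) = 0 , refl
  ... | even (suc m) with rec (1+m<2[1+m] m) (s≤s z≤n) t[1+m]≡0
    where
    t[1+m]≡0 : t (suc m) ≡ 0ℤ
    t[1+m]≡0 = trans (sym (ℤP.neg-involutive (t (suc m)))) (cong ℤ.-_ (trans (sym (t-double (suc m))) tn≡0))
  ...   | k , eq = suc k , trans (cong (2 *_) eq) (sym (*2^-suc 3 k))
  step n rec 1≤n tn≡0 | odd (suc (suc m)) =
    ⊥-elim (concordant-+≢0 (t-concordant (2 + m) (s≤s (s≤s z≤n))) sum≡0)
    where
    negate : ∀ a b → a ℤ.+ b ≡ ℤ.- (ℤ.- a ℤ.- b)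
    negate = ℤ-solve
    sum≡0 : t (2 + m) ℤ.+ t (3 + m) ≡ 0ℤ
    sum≡0 = trans (negate (t (2 + m)) (t (3 + m))) (cong ℤ.-_ (trans (sym (t-double+1 (2 + m) (s≤s z≤n))) tn≡0))
  step n rec () tn≡0 | even zero
  step n rec 1≤n () | odd zero

twisted-zeros : ∀ n → 1 ≤ n →
                ((∃ λ k → n ≡ 3 * 2 ^ k) → (t n ≡ 0ℤ) × (tNeighbourSum n ≡ 0ℤ)) ×
                ((¬ ∃ λ k → n ≡ 3 * 2 ^ k) → (t n ≢ 0ℤ) × (tNeighbourSum n ≢ 0ℤ) × (t n ℤD.∣ tNeighbourSum n))
twisted-zeros n 1≤n = at-3*2^ , off-3*2^
  where
  at-3*2^ : (∃ λ k → n ≡ 3 * 2 ^ k) → (t n ≡ 0ℤ) × (tNeighbourSum n ≡ 0ℤ)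
  at-3*2^ (k , refl) = t-3*2^ k , tNeighbourSum-3*2^ k

  off-3*2^ : (¬ ∃ λ k → n ≡ 3 * 2 ^ k) → (t n ≢ 0ℤ) × (tNeighbourSum n ≢ 0ℤ) × (t n ℤD.∣ tNeighbourSum n)
  off-3*2^ ¬3*2^ with tNeighbourSum-odd-multiple n 1≤n
  ... | x , eq = t≢0 , sum≢0 , ℕD.divides ℤ.∣ R ∣ (trans (cong ℤ.∣_∣ eq) (ℤP.abs-* R (t n)))
    where
    R : ℤ
    R = + 1 ℤ.+ + 2 ℤ.* x
    t≢0 : t n ≢ 0ℤ
    t≢0 = ¬3*2^ ∘ t≡0⇒3*2^ n 1≤n
    sum≢0 : tNeighbourSum n ≢ 0ℤ
    sum≢0 sum≡0 = [ 1+2x≢0 x , t≢0 ]′ (ℤP.i*j≡0⇒i≡0∨j≡0 R (trans (sym eq) sum≡0))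

tRatio-generic : ∀ n → 1 ≤ n → (¬ ∃ λ j → n ≡ 2 ^ j) → (¬ ∃ λ j → n ≡ 3 * 2 ^ j) →
                 tRatio n ≡ ℕtoℚ (1 + 2 * v2 n)
tRatio-generic n 1≤n ¬2^ ¬3*2^ with odd*2^-decomposition n 1≤n
... | zero  , k , refl = ⊥-elim (¬2^ (k , ℕP.*-identityˡ (2 ^ k)))
... | suc m , k , refl = begin
  divℤ (tNeighbourSum n) (t n)                   ≡⟨ cong (λ x → divℤ x (t n)) (tNeighbourSum-odd*2^ m k) ⟩
  divℤ ((+ 1 ℤ.+ + 2 ℤ.* + k) ℤ.* t n) (t n)     ≡⟨ divℤ-cancelʳ (+ 1 ℤ.+ + 2 ℤ.* + k) (t n) (¬3*2^ ∘ t≡0⇒3*2^ n 1≤n) ⟩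
  ℤtoℚ (+ 1 ℤ.+ + 2 ℤ.* + k)                     ≡⟨ cong (λ x → ℤtoℚ (ℤ._+_ (+ 1) x)) (ℤP.pos-* 2 k) ⟨
  ℕtoℚ (1 + 2 * k)                               ≡⟨ cong (λ v → ℕtoℚ (1 + 2 * v)) (v2-odd*2^ (suc m) k) ⟨
  ℕtoℚ (1 + 2 * v2 n)                            ∎
  where open ≡-Reasoning

tRatio-2^ : ∀ e → 1 ≤ e →
            divℤ (t (2 ^ e ∸ 1) ℤ.+ t (2 ^ e + 1)) (t (2 ^ e)) ≡ ℤtoℚ (+ 1 ℤ.+ + 2 ℤ.* (+ e ℤ.- + 2))
tRatio-2^ e 1≤e = begin
  divℤ (t (2 ^ e ∸ 1) ℤ.+ t (2 ^ e + 1)) (t (2 ^ e))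
    ≡⟨ cong (λ m → divℤ (t (2 ^ e ∸ 1) ℤ.+ t m) (t (2 ^ e))) (ℕP.+-comm (2 ^ e) 1) ⟩
  divℤ (tNeighbourSum (2 ^ e)) (t (2 ^ e))
    ≡⟨ cong (λ x → divℤ x (t (2 ^ e))) (tNeighbourSum-2^ e 1≤e) ⟩
  divℤ (R ℤ.* t (2 ^ e)) (t (2 ^ e))
    ≡⟨ divℤ-cancelʳ R (t (2 ^ e)) (IsUnit⇒≢0 (t-2^-unit e)) ⟩
  ℤtoℚ R ∎
  where
  open ≡-Reasoning
  R : ℤ
  R = + 1 ℤ.+ + 2 ℤ.* (+ e ℤ.- + 2)

mainTheorem8 :
    ((n : ℕ) → 1 ≤ n →
        (s n ℕD.∣ (s (n ∸ 1) ℕ.+ s (suc n)))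
        × (sRatio n ≡ ℕtoℚ (1 ℕ.+ 2 ℕ.* v2 n)))
    × (constCoeff Cser ≡ ℚ.0ℚ)
    × (((poly (ℚ.1ℚ ∷ ℚ.0ℚ ∷ ℚ.- ℚ.1ℚ ∷ [])) *PS (Cser -PS atZ² Cser))
         ≈PS poly (ℚ.0ℚ ∷ ℚ.1ℚ ∷ ℕtoℚ 2 ∷ []))
    × TwoRegular Cser
    × ((n : ℕ) → 1 ≤ n →
        ((Σ ℕ λ k → n ≡ 3 ℕ.* 2 ^ k) →
            (t n ≡ + 0) × (t (n ∸ 1) ℤ.+ t (suc n) ≡ + 0))
        × ((¬ Σ ℕ λ k → n ≡ 3 ℕ.* 2 ^ k) →
            (t n ≢ + 0) × (t (n ∸ 1) ℤ.+ t (suc n) ≢ + 0)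
            × (t n ℤD.∣ (t (n ∸ 1) ℤ.+ t (suc n)))))
    × ((n : ℕ) → 1 ≤ n →
        (¬ Σ ℕ λ j → n ≡ 2 ^ j) → (¬ Σ ℕ λ j → n ≡ 3 ℕ.* 2 ^ j) →
        tRatio n ≡ ℕtoℚ (1 ℕ.+ 2 ℕ.* v2 n))
    × (divℤ (t 0 ℤ.+ t 2) (t 1) ≡ ℚ.- ℚ.1ℚ)
    × ((e : ℕ) → 1 ≤ e →
        divℤ (t (2 ^ e ∸ 1) ℤ.+ t (2 ^ e ℕ.+ 1)) (t (2 ^ e))
          ≡ ℤtoℚ (+ 1 ℤ.+ + 2 ℤ.* (+ e ℤ.- + 2)))
mainTheorem8 =
  stern-ratio , refl , Cser-functional-equation , Cser-twoRegular ,
  twisted-zeros , tRatio-generic , refl , tRatio-2^
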